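{- Let $G=(V,E)$ be a simple, finite, connected reflective graph. Let $n\geq1$ and $x,x'\in V$ with $d(x,x')=n-1$, and assume the induced subgraph on $S_1(x)$ is connected. Then $S_1(x)\cap S_n(x')$ is isometric, i.e. for all $w,w'\in S_1(x)\cap S_n(x')$ there exists a shortest path in $G$ from $w$ to $w'$ all of whose vertices lie in $S_1(x)\cap S_n(x')$.
   Context: $d$ is the graph distance and $S_n(x)=\{y:d(x,y)=n\}$. For adjacent $x\sim y$ let $V_x^y=\{x': d(x',x)<d(x',y)\}$, $V^{xy}=\{z: d(z,x)=d(z,y)\}$. A reflection from $x$ to $y$ is a graph automorphism $\phi$ with $\phi^2=\mathrm{id}$, $\phi(x)=y$, such that the set of edges between $V_x^y$ and $V_y^x$ is exactly $\{(x',\phi(x')):x'\in V_x^y\}$, and $\phi$ fixes every vertex of $V^{xy}$. $G$ is reflective if a reflection from $x$ to $y$ exists for every edge $x\sim y$. -}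

module Defs where

open import Data.Nat using (ℕ; zero; suc; _<_)
open import Data.Fin using (Fin; zero; suc; fromℕ; inject₁)
open import Data.Product using (Σ; ∃; _×_; _,_)
open import Relation.Binary.PropositionalEquality using (_≡_)
open import Relation.Nullary using (¬_)

record Graph : Set₁ where
  field
    size    : ℕ
    Adj     : Fin size → Fin size → Set
    sym     : ∀ {a b} → Adj a b → Adj b a
    irrefl  : ∀ {a} → ¬ Adj a a

module _ (G : Graph) where
  open Graph G

  V : Set
  V = Fin size

  Walk : V → V → ℕ → Set
  Walk x y k = Σ (Fin (suc k) → V) λ p →
    (p zero ≡ x) × (p (fromℕ k) ≡ y) × (∀ (i : Fin k) → Adj (p (inject₁ i)) (p (suc i)))

  WalkIn : (V → Set) → V → V → ℕ → Set
  WalkIn P x y k = Σ (Fin (suc k) → V) λ p →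
    (p zero ≡ x) × (p (fromℕ k) ≡ y) × (∀ (i : Fin k) → Adj (p (inject₁ i)) (p (suc i)))
      × (∀ (j : Fin (suc k)) → P (p j))

  Dist : V → V → ℕ → Set
  Dist x y n = Walk x y n × (∀ m → m < n → ¬ Walk x y m)

  Connected : Set
  Connected = ∀ x y → ∃ λ n → Walk x y n

  Sphere : ℕ → V → V → Set
  Sphere n x y = Dist x y n

  Half : V → V → V → Set
  Half x y z = ∃ λ m → ∃ λ n → Dist z x m × Dist z y n × m < n

  Bisector : V → V → V → Set
  Bisector x y z = ∃ λ m → Dist z x m × Dist z y m

  -- Graph automorphism (bijectivity follows from being an involution below).
  IsAutomorphism : (V → V) → Set
  IsAutomorphism φ = ∀ a b → (Adj a b → Adj (φ a) (φ b)) × (Adj (φ a) (φ b) → Adj a b)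

  record IsReflection (x y : V) (φ : V → V) : Set where
    field
      auto      : IsAutomorphism φ
      invol     : ∀ a → φ (φ a) ≡ a
      maps      : φ x ≡ y
      edge-in   : ∀ a → Half x y a → Half y x (φ a) × Adj a (φ a)
      edge-only : ∀ a b → Half x y a → Half y x b → Adj a b → b ≡ φ a
      fixes     : ∀ z → Bisector x y z → φ z ≡ z

  Reflective : Set
  Reflective = ∀ x y → Adj x y → Σ (V → V) (IsReflection x y)

  S1Connected : V → Set
  S1Connected x = ∀ a b → Sphere 1 x a → Sphere 1 x b → ∃ λ k → WalkIn (Sphere 1 x) a b k

-- Write n = n₀ + 1 and take non-adjacent w ≠ w' in S₁(x) ∩ Sₙ(x').  Connectivity of S₁(x),
-- together with the reflections at the edges x ∼ a, turns any path inside S₁(x) into a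
-- common neighbour v ∈ S₁(x) of w and w'.  If the reflection from x to v moves x', then
-- x' is not equidistant from x and v, which forces v ∈ Sₙ(x').  Otherwise d(x', v) = n₀,
-- so x' and w' both lie on the v-side of the reflection ρ from v to w; since a reflection
-- never brings a point of its own side closer, ρ w' is a common neighbour of w and w'
-- lying in S₁(x) ∩ Sₙ(x').
module Submission where

open import Defs
open import Data.Nat using (ℕ; zero; suc; _≤_; _<_; _∸_; z≤n; s≤s)
open import Data.Nat.Properties
  using (<-cmp; <-irrefl; <-trans; ≤-refl; ≤-<-trans; n≤1+n; m<1+n⇒m<n∨m≡n)
open import Data.Nat.Induction using (<-rec)
open import Data.Fin using (zero; suc; _≟_)
open import Data.Product using (∃; _×_; _,_; proj₁; proj₂)
open import Data.Sum using (_⊎_; inj₁; inj₂)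
open import Data.Empty using (⊥; ⊥-elim)
open import Relation.Nullary using (¬_; yes; no)
open import Relation.Nullary.Decidable using (¬¬-excluded-middle)
open import Relation.Binary using (tri<; tri≈; tri>)
open import Relation.Binary.PropositionalEquality
  using (_≡_; refl; sym; trans; cong; subst; subst₂)

module Properties (G : Graph) where
  open Graph G renaming (sym to Adj-sym)

  infixr 5 _∷_

  data Path : V G → V G → ℕ → Set where
    []  : ∀ {a} → Path a a 0
    _∷_ : ∀ {a b c k} → Adj a b → Path b c k → Path a c (suc k)

  data PathIn (P : V G → Set) : V G → V G → ℕ → Set where
    []   : ∀ {a} → P a → PathIn P a a 0
    cons : ∀ {a b c k} → P a → Adj a b → PathIn P b c k → PathIn P a c (suc k)

  walk⇒path : ∀ {a b} k → Walk G a b k → Path a b k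
  walk⇒path zero    (p , refl , refl , _) = []
  walk⇒path (suc k) (p , refl , end , adj) =
    adj zero ∷ walk⇒path k ((λ i → p (suc i)) , refl , end , λ i → adj (suc i))

  path⇒walk : ∀ {a b k} → Path a b k → Walk G a b k
  path⇒walk {a} [] = (λ _ → a) , refl , refl , λ ()
  path⇒walk {a} (e ∷ P) with path⇒walk P
  ... | p , refl , end , adj =
    (λ { zero → a ; (suc i) → p i }) , refl , end , λ { zero → e ; (suc i) → adj i }

  walkIn⇒pathIn : ∀ {P a b} k → WalkIn G P a b k → PathIn P a b k
  walkIn⇒pathIn zero    (p , refl , refl , _ , inP) = [] (inP zero)
  walkIn⇒pathIn (suc k) (p , refl , end , adj , inP) =
    cons (inP zero) (adj zero)
      (walkIn⇒pathIn k ((λ i → p (suc i)) , refl , end , (λ i → adj (suc i)) , λ j → inP (suc j)))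

  pathIn⇒walkIn : ∀ {P a b k} → PathIn P a b k → WalkIn G P a b k
  pathIn⇒walkIn {a = a} ([] a∈) = (λ _ → a) , refl , refl , (λ ()) , λ _ → a∈
  pathIn⇒walkIn {a = a} (cons a∈ e P) with pathIn⇒walkIn P
  ... | p , refl , end , adj , inP =
    (λ { zero → a ; (suc i) → p i }) , refl , end , (λ { zero → e ; (suc i) → adj i }) ,
    λ { zero → a∈ ; (suc j) → inP j }

  head-PathIn : ∀ {P a b k} → PathIn P a b k → P a
  head-PathIn ([] a∈)       = a∈
  head-PathIn (cons a∈ _ _) = a∈

  _∷ʳ_ : ∀ {a b c k} → Path a b k → Adj b c → Path a c (suc k)
  []      ∷ʳ e = e ∷ []
  (e' ∷ P) ∷ʳ e = e' ∷ (P ∷ʳ e)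

  reverse : ∀ {a b k} → Path a b k → Path b a k
  reverse []      = []
  reverse (e ∷ P) = reverse P ∷ʳ Adj-sym e

  Path₀⇒≡ : ∀ {a b} → Path a b 0 → a ≡ b
  Path₀⇒≡ [] = refl

  Path₁⇒Adj : ∀ {a b} → Path a b 1 → Adj a b
  Path₁⇒Adj (e ∷ []) = e

  map-Path : ∀ {φ} → IsAutomorphism G φ → ∀ {a b k} → Path a b k → Path (φ a) (φ b) k
  map-Path φ-auto []                  = []
  map-Path φ-auto (_∷_ {a} {b} e P) = proj₁ (φ-auto a b) e ∷ map-Path φ-auto P

  shortest : ∀ {a b k} → Dist G a b k → Path a b k
  shortest {k = k} d = walk⇒path k (proj₁ d)

  shortest-minimal : ∀ {a b k m} → Dist G a b k → m < k → ¬ Path a b m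
  shortest-minimal {m = m} d m<k P = proj₂ d m m<k (path⇒walk P)

  Path⇒Dist : ∀ {a b k} → Path a b k → (∀ {m} → m < k → ¬ Path a b m) → Dist G a b k
  Path⇒Dist P minimal = path⇒walk P , λ m m<k W → minimal m<k (walk⇒path m W)

  Dist-refl : ∀ {a} → Dist G a a 0
  Dist-refl = Path⇒Dist [] λ ()

  Dist-sym : ∀ {a b k} → Dist G a b k → Dist G b a k
  Dist-sym d = Path⇒Dist (reverse (shortest d)) λ m<k P → shortest-minimal d m<k (reverse P)

  Dist-functional : ∀ {a b k k'} → Dist G a b k → Dist G a b k' → k ≡ k'
  Dist-functional {k = k} {k'} d d' with <-cmp k k'
  ... | tri< k<k' _ _ = ⊥-elim (shortest-minimal d' k<k' (shortest d))
  ... | tri≈ _ k≡k' _ = k≡k'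
  ... | tri> _ _ k>k' = ⊥-elim (shortest-minimal d k>k' (shortest d'))

  Adj⇒Dist₁ : ∀ {a b} → Adj a b → Dist G a b 1
  Adj⇒Dist₁ {a} e = Path⇒Dist (e ∷ []) λ { (s≤s z≤n) P → irrefl (subst (Adj a) (sym (Path₀⇒≡ P)) e) }

  Dist₁⇒Adj : ∀ {a b} → Dist G a b 1 → Adj a b
  Dist₁⇒Adj d = Path₁⇒Adj (shortest d)

  Dist₂ : ∀ {a b} → Path a b 2 → ¬ a ≡ b → ¬ Adj a b → Dist G a b 2
  Dist₂ P a≢b a≁b = Path⇒Dist P λ
    { (s≤s z≤n)       Q → a≢b (Path₀⇒≡ Q)
    ; (s≤s (s≤s z≤n)) Q → a≁b (Path₁⇒Adj Q) }

  Dist-image : ∀ {φ} → IsAutomorphism G φ → (∀ a → φ (φ a) ≡ a) →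
               ∀ {a b k} → Dist G a b k → Dist G (φ a) (φ b) k
  Dist-image {φ} φ-auto φ-invol {a} {b} d = Path⇒Dist (map-Path φ-auto (shortest d)) λ {m} m<k P →
    shortest-minimal d m<k (subst₂ (λ s t → Path s t m) (φ-invol a) (φ-invol b) (map-Path φ-auto P))

  Sphere-image : ∀ {φ} → IsAutomorphism G φ → (∀ a → φ (φ a) ≡ a) →
                 ∀ {n x y} → φ x ≡ x → Sphere G n x y → Sphere G n x (φ y)
  Sphere-image {φ} φ-auto φ-invol {n} {y = y} φx≡x y∈ =
    subst (λ t → Dist G t (φ y) n) φx≡x (Dist-image φ-auto φ-invol y∈)

  -- Distances exist only classically: Adj is not decidable, so no search is possible.
  Path⇒¬¬Dist : ∀ {a b k} → Path a b k → ¬ ¬ ∃ (Dist G a b)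
  Path⇒¬¬Dist {a} {b} {k} = <-rec (λ k → Path a b k → ¬ ¬ ∃ (Dist G a b)) step k
    where
    step : ∀ k → (∀ {m} → m < k → Path a b m → ¬ ¬ ∃ (Dist G a b)) →
           Path a b k → ¬ ¬ ∃ (Dist G a b)
    step k shorter P ∄d = ¬¬-excluded-middle {A = ∃ λ m → m < k × Path a b m} λ
      { (yes (m , m<k , Q)) → shorter m<k Q ∄d
      ; (no none) → ∄d (k , Path⇒Dist P λ m<k Q → none (_ , m<k , Q)) }

  module Reflection {a b ρ} (r : IsReflection G a b ρ) where
    open IsReflection r

    maps⁻¹ : ρ b ≡ a
    maps⁻¹ = trans (cong ρ (sym maps)) (invol a)

    Half-disjoint : ∀ {y} → Half G a b y → ¬ Half G b a y
    Half-disjoint (m₁ , m₂ , y-a , y-b , m₁<m₂) (n₁ , n₂ , y-b' , y-a' , n₁<n₂)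
      with Dist-functional y-a y-a' | Dist-functional y-b y-b'
    ... | refl | refl = <-irrefl refl (<-trans m₁<m₂ n₁<n₂)

    Half-neighbour : ∀ {p q k₁ k₂} → Half G a b p → Adj p q → Dist G q a k₁ → Dist G q b k₂ →
                     Half G a b q ⊎ ρ q ≡ q ⊎ q ≡ ρ p
    Half-neighbour {p} {q} {k₁} {k₂} p∈ p~q q-a q-b with <-cmp k₁ k₂
    ... | tri< k₁<k₂ _ _ = inj₁ (k₁ , k₂ , q-a , q-b , k₁<k₂)
    ... | tri≈ _ refl _ = inj₂ (inj₁ (fixes q (k₁ , q-a , q-b)))
    ... | tri> _ _ k₁>k₂ = inj₂ (inj₂ (edge-only p q p∈ (k₂ , k₁ , q-b , q-a , k₁>k₂) p~q))

    ¬¬Half-neighbour : ∀ {p q} → ¬ ¬ Half G a b p → Adj p q → ¬ ρ q ≡ q → ¬ q ≡ ρ p →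
                       ¬ ¬ Half G a b q
    ¬¬Half-neighbour {p} {q} ¬¬p∈ p~q ρq≢q q≢ρp q∉ = ¬¬p∈ λ { p∈@(_ , _ , p-a , p-b , _) →
      Path⇒¬¬Dist (Adj-sym p~q ∷ shortest p-a) λ { (_ , q-a) →
      Path⇒¬¬Dist (Adj-sym p~q ∷ shortest p-b) λ { (_ , q-b) →
      case-Half (Half-neighbour p∈ p~q q-a q-b) } } }
      where
      case-Half : Half G a b q ⊎ ρ q ≡ q ⊎ q ≡ ρ p → ⊥
      case-Half (inj₁ q∈)          = q∉ q∈
      case-Half (inj₂ (inj₁ ρq≡q)) = ρq≢q ρq≡q
      case-Half (inj₂ (inj₂ q≡ρp)) = q≢ρp q≡ρp

    -- While the path stays in V_a^b keep it; its first step out either lands on a fixed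
    -- vertex or crosses an edge (p, ρ p), and from there the reflected remainder reaches ρ y.
    reflected-shortcut : ∀ {p y j} → ¬ ¬ Half G a b p → Path p y j → Half G b a y →
                         ∃ λ m → m ≤ j × Path p (ρ y) m
    reflected-shortcut ¬¬y∈ [] y∈ = ⊥-elim (¬¬y∈ λ y∈' → Half-disjoint y∈' y∈)
    reflected-shortcut {p} {y} {suc j} ¬¬p∈ (_∷_ {b = q} p~q rest) y∈ with ρ q ≟ q | q ≟ ρ p
    ... | yes ρq≡q | _ =
      suc j , ≤-refl , p~q ∷ subst (λ t → Path t (ρ y) j) ρq≡q (map-Path auto rest)
    ... | no _ | yes q≡ρp =
      j , n≤1+n j , subst (λ t → Path t (ρ y) j) (trans (cong ρ q≡ρp) (invol p)) (map-Path auto rest)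
    ... | no ρq≢q | no q≢ρp with reflected-shortcut (¬¬Half-neighbour ¬¬p∈ p~q ρq≢q q≢ρp) rest y∈
    ...   | m , m≤j , Q = suc m , s≤s m≤j , p~q ∷ Q

    reflection-not-closer : ∀ {p y k m} → Half G a b p → Half G a b y → Dist G p y k → m < k →
                            ¬ Path p (ρ y) m
    reflection-not-closer {p} p∈ y∈ p-y m<k P
      with reflected-shortcut (λ p∉ → p∉ p∈) P (proj₁ (edge-in _ y∈))
    ... | m' , m'≤m , Q =
      shortest-minimal p-y (≤-<-trans m'≤m m<k) (subst (λ t → Path p t _) (invol _) Q)

    mirrored-two-step : ∀ {c d} → ρ d ≡ d → Adj b c → Adj c d → Adj a (ρ c) × Adj (ρ c) d
    mirrored-two-step {c} {d} ρd≡d b~c c~d =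
      subst (λ t → Adj t (ρ c)) maps⁻¹ (proj₁ (auto b c) b~c) ,
      subst (Adj (ρ c)) ρd≡d (proj₁ (auto c d) c~d)

  data Adjacency (a b : V G) : Set where
    equal    : a ≡ b → Adjacency a b
    adjacent : Adj a b → Adjacency a b
    apart    : ¬ a ≡ b → ¬ Adj a b → Adjacency a b

  data Within₂ (P : V G → Set) (a b : V G) : Set where
    equal    : a ≡ b → Within₂ P a b
    adjacent : Adj a b → Within₂ P a b
    via      : ∀ {c} → P c → Adj a c → Adj c b → Within₂ P a b

  Path-via-centre : ∀ {x x' t n} → Dist G x x' n → Adj x t → Path x' t (suc n)
  Path-via-centre x-x' x~t = reverse (shortest x-x') ∷ʳ x~t

  Sphere-neighbour-far : ∀ {x' v w n m} → Sphere G (suc n) x' w → Adj v w → m < n → ¬ Path x' v m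
  Sphere-neighbour-far w∈ v~w (s≤s m<n) P = shortest-minimal w∈ (s≤s (s≤s m<n)) (P ∷ʳ v~w)

  outer-neighbour : ∀ {x x' v w n} → Dist G x x' n → Adj x v → Adj v w → Sphere G (suc n) x' w →
                    ¬ Bisector G x v x' → Sphere G (suc n) x' v
  outer-neighbour {x' = x'} {v} {n = n} x-x' x~v v~w w∈ x'∉ = Path⇒Dist (Path-via-centre x-x' x~v) shorter
    where
    shorter : ∀ {m} → m < suc n → ¬ Path x' v m
    shorter (s≤s m≤n) P with m<1+n⇒m<n∨m≡n (s≤s m≤n)
    ... | inj₁ m<n  = Sphere-neighbour-far w∈ v~w m<n P
    ... | inj₂ refl = x'∉ (n , Dist-sym x-x' , Path⇒Dist P (Sphere-neighbour-far w∈ v~w))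

  module _ (RG : Reflective G) where

    -- Adj is undecidable in general, but for neighbours a, b of x the test ρ b ≟ b decides it,
    -- ρ being the reflection from x to a.
    adjacency : ∀ {x a b} → Adj x a → Adj x b → Adjacency a b
    adjacency {x} {a} {b} x~a x~b with RG x a x~a
    ... | ρ , r with a ≟ b
    ...   | yes a≡b = equal a≡b
    ...   | no a≢b with ρ b ≟ b
    ...     | yes ρb≡b =
      adjacent (subst₂ Adj (IsReflection.maps r) ρb≡b (proj₁ (IsReflection.auto r x b) x~b))
    ...     | no ρb≢b =
      apart a≢b λ a~b → ρb≢b (IsReflection.fixes r b (1 , Adj⇒Dist₁ (Adj-sym x~b) , Adj⇒Dist₁ (Adj-sym a~b)))

    Sphere₁-within₂ : ∀ {x a b k} → PathIn (Sphere G 1 x) a b k → Sphere G 1 x b →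
                      Within₂ (Sphere G 1 x) a b
    Sphere₁-within₂ ([] _) _ = equal refl
    Sphere₁-within₂ {x} {a} {b} (cons a∈ a~u rest) b∈
      with adjacency (Dist₁⇒Adj a∈) (Dist₁⇒Adj b∈)
         | adjacency (Dist₁⇒Adj (head-PathIn rest)) (Dist₁⇒Adj b∈)
         | Sphere₁-within₂ rest b∈
    ... | equal a≡b       | _               | _     = equal a≡b
    ... | adjacent a~b    | _               | _     = adjacent a~b
    ... | apart _ a≁b     | equal refl      | _     = ⊥-elim (a≁b a~u)
    ... | apart _ _       | adjacent u~b    | _     = via (head-PathIn rest) a~u u~b
    ... | apart _ _       | apart u≢b _     | equal u≡b    = ⊥-elim (u≢b u≡b)
    ... | apart _ _       | apart _ u≁b     | adjacent u~b = ⊥-elim (u≁b u~b)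
    ... | apart a≢b a≁b   | apart u≢b u≁b   | via c∈ u~c c~b with RG _ _ a~u
    ...   | ρ , r = via (Sphere-image auto invol ρx≡x c∈) a~ρc ρc~b
      where
      open IsReflection r
      open Reflection r using (mirrored-two-step)
      x~a = Dist₁⇒Adj a∈
      x~u = Dist₁⇒Adj (head-PathIn rest)
      x~b = Dist₁⇒Adj b∈
      ρx≡x : ρ x ≡ x
      ρx≡x = fixes x (1 , a∈ , head-PathIn rest)
      ρb≡b : ρ b ≡ b
      ρb≡b = fixes b (2 , Dist₂ (Adj-sym x~b ∷ x~a ∷ []) (λ b≡a → a≢b (sym b≡a)) (λ b~a → a≁b (Adj-sym b~a))
                        , Dist₂ (Adj-sym x~b ∷ x~u ∷ []) (λ b≡u → u≢b (sym b≡u)) (λ b~u → u≁b (Adj-sym b~u)))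
      a~ρc = proj₁ (mirrored-two-step ρb≡b u~c c~b)
      ρc~b = proj₂ (mirrored-two-step ρb≡b u~c c~b)

    common-neighbour-in-spheres :
      ∀ {n x x' w w' v} → Dist G x x' n →
      Sphere G 1 x w → Sphere G (suc n) x' w → Sphere G 1 x w' → Sphere G (suc n) x' w' →
      ¬ w ≡ w' → ¬ Adj w w' → Sphere G 1 x v → Adj w v → Adj v w' →
      ∃ λ u → (Sphere G 1 x u × Sphere G (suc n) x' u) × Adj w u × Adj u w'
    common-neighbour-in-spheres {n} {x} {x'} {w} {w'} {v} x-x' w∈₁ w∈ₙ w'∈₁ w'∈ₙ w≢w' w≁w' v∈₁ w~v v~w'
      with RG x v (Dist₁⇒Adj v∈₁)
    ... | σ , s with σ x' ≟ x'
    ...   | no σx'≢x' =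
      v , (v∈₁ , outer-neighbour x-x' (Dist₁⇒Adj v∈₁) (Adj-sym w~v) w∈ₙ
                   λ x'∈ → σx'≢x' (IsReflection.fixes s x' x'∈)) , w~v , v~w'
    ...   | yes σx'≡x' with RG v w (Adj-sym w~v)
    ...     | ρ , r = ρ w' , (u∈₁ , u∈ₙ) , w~u , u~w'
      where
      open IsReflection r
      x'-v : Dist G x' v n
      x'-v = subst₂ (λ s t → Dist G s t n) σx'≡x' (IsReflection.maps s)
               (Dist-image (IsReflection.auto s) (IsReflection.invol s) (Dist-sym x-x'))
      x'∈ : Half G v w x'
      x'∈ = n , suc n , x'-v , w∈ₙ , ≤-refl
      w'∈ : Half G v w w'
      w'∈ = 1 , 2 , Adj⇒Dist₁ (Adj-sym v~w') ,
            Dist₂ (Adj-sym (Dist₁⇒Adj w'∈₁) ∷ Dist₁⇒Adj w∈₁ ∷ [])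
              (λ w'≡w → w≢w' (sym w'≡w)) (λ w'~w → w≁w' (Adj-sym w'~w)) ,
            s≤s (s≤s z≤n)
      u∈₁ : Sphere G 1 x (ρ w')
      u∈₁ = Sphere-image auto invol (fixes x (1 , v∈₁ , w∈₁)) w'∈₁
      u∈ₙ : Sphere G (suc n) x' (ρ w')
      u∈ₙ = Path⇒Dist (Path-via-centre x-x' (Dist₁⇒Adj u∈₁))
              (Reflection.reflection-not-closer r x'∈ w'∈ w'∈ₙ)
      w~u : Adj w (ρ w')
      w~u = subst (λ t → Adj t (ρ w')) maps (proj₁ (auto v w') v~w')
      u~w' : Adj (ρ w') w'
      u~w' = Adj-sym (proj₂ (edge-in w' w'∈))

lemma2p11 : (G : Graph) → Connected G → Reflective G →
    (n : ℕ) → 1 ≤ n → (x x' : V G) → Dist G x x' (n ∸ 1) → S1Connected G x →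
    ∀ w w' → Sphere G 1 x w → Sphere G n x' w → Sphere G 1 x w' → Sphere G n x' w' →
    ∃ λ k → Dist G w w' k × WalkIn G (λ v → Sphere G 1 x v × Sphere G n x' v) w w' k
lemma2p11 G _ RG (suc n) (s≤s z≤n) x x' x-x' S₁-connected w w' w∈₁ w∈ₙ w'∈₁ w'∈ₙ =
  geodesic (adjacency RG (Dist₁⇒Adj w∈₁) (Dist₁⇒Adj w'∈₁))
  where
  open Properties G
  geodesic : Adjacency w w' →
    ∃ λ k → Dist G w w' k × WalkIn G (λ v → Sphere G 1 x v × Sphere G (suc n) x' v) w w' k
  geodesic (equal refl)      = 0 , Dist-refl , pathIn⇒walkIn ([] (w∈₁ , w∈ₙ))
  geodesic (adjacent w~w')   =
    1 , Adj⇒Dist₁ w~w' , pathIn⇒walkIn (cons (w∈₁ , w∈ₙ) w~w' ([] (w'∈₁ , w'∈ₙ)))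
  geodesic (apart w≢w' w≁w') with Sphere₁-within₂ RG
      (walkIn⇒pathIn _ (proj₂ (S₁-connected w w' w∈₁ w'∈₁))) w'∈₁
  ... | equal w≡w'    = ⊥-elim (w≢w' w≡w')
  ... | adjacent w~w' = ⊥-elim (w≁w' w~w')
  ... | via v∈₁ w~v v~w' with common-neighbour-in-spheres RG x-x' w∈₁ w∈ₙ w'∈₁ w'∈ₙ w≢w' w≁w' v∈₁ w~v v~w'
  ...   | u , u∈ , w~u , u~w' =
    2 , Dist₂ (w~u ∷ u~w' ∷ []) w≢w' w≁w' ,
    pathIn⇒walkIn (cons (w∈₁ , w∈ₙ) w~u (cons u∈ u~w' ([] (w'∈₁ , w'∈ₙ))))
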